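{- Let $(\mathcal P,\Phi)$ and $(\mathcal Q,\Psi)$ be rooted $n$-polytopes. Then there is a surjective color-preserving graph homomorphism from $T(\mathcal P,\Phi)\diamond T(\mathcal Q,\Psi)$ onto $T\big((\mathcal P,\Phi)\diamond(\mathcal Q,\Psi)\big)$.
   Context: An $n$-polytope is an abstract polytope of rank $n$ (a ranked poset with ranks $-1,\dots,n$, unique minimal and maximal faces, all flags of size $n+2$, the diamond condition and strong connectivity). For a flag $\Phi$ and $i\in\{0,\dots,n-1\}$, $\Phi^i$ is the unique flag differing from $\Phi$ exactly in its $i$-face. A rooted polytope is a pair $(\mathcal P,\Phi)$ with $\Phi$ a flag of $\mathcal P$. The flag graph $\mathcal G_{\mathcal P}$ has the flags as vertices and an edge labeled $i$ between $\Phi$ and $\Phi^i$. More generally, a maniplex of rank $n$ is a connected graph with edges colored $0,\dots,n-1$ in which every vertex lies on exactly one edge of each color, and for $|i-j|\ge2$ every $i,j$-alternating path of length $4$ closes up; its vertices are called flags, its automorphisms are color-preserving graph automorphisms, and a rooted maniplex is a maniplex with a chosen vertex. The mix $(\mathcal P,\Phi)\diamond(\mathcal Q,\Psi)$ is the rooted maniplex obtained as follows: on the vertex set $V(\mathcal G_{\mathcal P})\times V(\mathcal G_{\mathcal Q})$ put an $i$-edge between $(\Phi_1,\Psi_1)$ and $(\Phi_2,\Psi_2)$ iff $\Phi_1,\Phi_2$ are joined by an $i$-edge in $\mathcal G_{\mathcal P}$ and $\Psi_1,\Psi_2$ are joined by an $i$-edge in $\mathcal G_{\mathcal Q}$; take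 the connected component containing $(\Phi,\Psi)$, rooted at $(\Phi,\Psi)$. The symmetry type graph $T(\mathcal M)$ of a polytope or maniplex $\mathcal M$ is the quotient of its flag graph by its automorphism group: one vertex per flag orbit, an $i$-edge between the orbits of $\Phi$ and $\Phi^i$, which is a semi-edge (loop) when these orbits coincide. $T(\mathcal P,\Phi)$ is $T(\mathcal P)$ with the orbit of $\Phi$ as distinguished vertex; for a rooted maniplex the symmetry type graph is that of the underlying maniplex. The mix $T(\mathcal P,\Phi)\diamond T(\mathcal Q,\Psi)$ is defined like the mix of flag graphs (semi-edges treated as $i$-edges from a vertex to itself): the connected component containing the pair of distinguished vertices of the graph on $V(T(\mathcal P))\times V(T(\mathcal Q))$ in which $(u_1,v_1)$ and $(u_2,v_2)$ are $i$-adjacent iff $u_1,u_2$ are $i$-adjacent and $v_1,v_2$ are $i$-adjacent. -}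

module Defs where

open import Data.Nat using (ℕ; suc; _+_)
import Data.Nat as ℕ
open import Data.Fin using (Fin; toℕ; fromℕ) renaming (zero to fzero)
import Data.Fin as F
open import Data.Product using (Σ; ∃; ∃₂; _×_; _,_; proj₁; proj₂)
open import Data.Sum using (_⊎_)
open import Relation.Binary.PropositionalEquality using (_≡_; _≢_)
open import Relation.Binary.Construct.Closure.ReflexiveTransitive using (Star)

-- Abstract polytopes of rank n.
-- Ranks -1,0,…,n are encoded by Fin (n + 2): the face of rank k has
-- rank index k + 1 (so the least face has index 0, the greatest n+1).

record Polytope (n : ℕ) : Set₁ where
  field
    Face     : Set
    _≤_      : Face → Face → Set
    ≤-refl   : ∀ F → F ≤ F
    ≤-antisym : ∀ {F G} → F ≤ G → G ≤ F → F ≡ G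
    ≤-trans  : ∀ {F G H} → F ≤ G → G ≤ H → F ≤ H

  _<_ : Face → Face → Set
  F < G = F ≤ G × F ≢ G

  IsChain : (Face → Set) → Set
  IsChain C = ∀ F G → C F → C G → F ≤ G ⊎ G ≤ F

  IsMaximalChain : (Face → Set) → Set
  IsMaximalChain C = IsChain C × (∀ H → (∀ F → C F → H ≤ F ⊎ F ≤ H) → C H)

  Between : Face → Face → Face → Set
  Between F H G = F < H × H < G

  field
    rank      : Face → Fin (suc (suc n))
    rank-mono : ∀ {F G} → F < G → rank F F.< rank G
    -- unique minimal and maximal faces (uniqueness follows from antisymmetry)
    bottom    : Face
    bottom-≤  : ∀ F → bottom ≤ F
    top       : Face
    ≤-top     : ∀ F → F ≤ top
    rank-bottom : rank bottom ≡ fzero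
    rank-top    : rank top ≡ fromℕ (suc n)
    -- every maximal chain has n + 2 elements, i.e. contains a face of
    -- every rank (faces of a chain have pairwise distinct ranks)
    flags-full : ∀ C → IsMaximalChain C → ∀ r → ∃ λ F → C F × rank F ≡ r
    diamond : ∀ F G → F ≤ G → toℕ (rank G) ≡ 2 + toℕ (rank F) →
              ∃₂ λ H₁ H₂ → H₁ ≢ H₂ × Between F H₁ G × Between F H₂ G ×
                (∀ H → Between F H G → H ≡ H₁ ⊎ H ≡ H₂)
    strongly-connected : ∀ F G → F ≤ G → 3 + toℕ (rank F) ℕ.≤ toℕ (rank G) →
      ∀ H K → Between F H G → Between F K G →
      Star (λ X Y → Between F X G × Between F Y G × (X ≤ Y ⊎ Y ≤ X)) H K

record Flag {n : ℕ} (P : Polytope n) : Set where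
  open Polytope P
  field
    face       : Fin (suc (suc n)) → Face
    face-rank  : ∀ i → rank (face i) ≡ i
    face-chain : ∀ i j → i F.≤ j → face i ≤ face j
open Flag public

_≈F_ : ∀ {n} {P : Polytope n} → Flag P → Flag P → Set
Φ ≈F Ψ = ∀ k → face Φ k ≡ face Ψ k

-- Φ and Ψ differ exactly in their i-face (i ∈ {0,…,n-1}; rank i has index i+1)
Adj : ∀ {n} {P : Polytope n} → Fin n → Flag P → Flag P → Set
Adj i Φ Ψ = (∀ k → k ≢ F.suc (F.inject₁ i) → face Φ k ≡ face Ψ k)
          × face Φ (F.suc (F.inject₁ i)) ≢ face Ψ (F.suc (F.inject₁ i))

record PolyAut {n : ℕ} (P : Polytope n) : Set where
  open Polytope P
  field
    σ       : Face → Face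
    σ⁻¹     : Face → Face
    σσ⁻¹    : ∀ F → σ (σ⁻¹ F) ≡ F
    σ⁻¹σ    : ∀ F → σ⁻¹ (σ F) ≡ F
    σ-mono  : ∀ {F G} → F ≤ G → σ F ≤ σ G
    σ-refl  : ∀ {F G} → σ F ≤ σ G → F ≤ G

SameOrbitP : ∀ {n} {P : Polytope n} → Flag P → Flag P → Set
SameOrbitP {P = P} Φ Ψ = Σ (PolyAut P) λ α → ∀ k → PolyAut.σ α (face Φ k) ≡ face Ψ k

-- Edge-coloured graphs (colours Fin n), with vertex equality given as a
-- setoid-style relation (needed to represent quotients).

record CGraph (n : ℕ) : Set₁ where
  field
    V   : Set
    _≈_ : V → V → Set
    E   : Fin n → V → V → Set
open CGraph public

FlagGraph : ∀ {n} → Polytope n → CGraph n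
FlagGraph P = record { V = Flag P ; _≈_ = _≈F_ ; E = Adj }

data Reach {n} (G : CGraph n) (r : V G) : V G → Set where
  here : ∀ {x} → _≈_ G x r → Reach G r x
  step : ∀ {x y} (i : Fin n) → Reach G r x → E G i x y → Reach G r y

Component : ∀ {n} (G : CGraph n) → V G → CGraph n
Component G r = record
  { V = Σ (V G) (Reach G r)
  ; _≈_ = λ x y → _≈_ G (proj₁ x) (proj₁ y)
  ; E = λ i x y → E G i (proj₁ x) (proj₁ y) }

Product : ∀ {n} → CGraph n → CGraph n → CGraph n
Product G H = record
  { V = V G × V H
  ; _≈_ = λ x y → _≈_ G (proj₁ x) (proj₁ y) × _≈_ H (proj₂ x) (proj₂ y)
  ; E = λ i x y → E G i (proj₁ x) (proj₁ y) × E H i (proj₂ x) (proj₂ y) }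

Mix : ∀ {n} (G : CGraph n) → V G → (H : CGraph n) → V H → CGraph n
Mix G r H s = Component (Product G H) (r , s)

record GraphAut {n} (G : CGraph n) : Set where
  field
    f      : V G → V G
    g      : V G → V G
    f-cong : ∀ {x y} → _≈_ G x y → _≈_ G (f x) (f y)
    g-cong : ∀ {x y} → _≈_ G x y → _≈_ G (g x) (g y)
    fg     : ∀ x → _≈_ G (f (g x)) x
    gf     : ∀ x → _≈_ G (g (f x)) x
    f-hom  : ∀ i {x y} → E G i x y → E G i (f x) (f y)
    g-hom  : ∀ i {x y} → E G i x y → E G i (g x) (g y)

SameOrbitG : ∀ {n} (G : CGraph n) → V G → V G → Set
SameOrbitG G x y = Σ (GraphAut G) λ α → _≈_ G (GraphAut.f α x) y

-- quotient of a coloured graph by an orbit relation: one vertex per orbit,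
-- an i-edge between orbits [x],[y] iff some representatives are i-adjacent
-- (an i-edge from an orbit to itself is a semi-edge)
Quotient : ∀ {n} (G : CGraph n) → (V G → V G → Set) → CGraph n
Quotient G _~_ = record
  { V = V G
  ; _≈_ = _~_
  ; E = λ i x y → ∃₂ λ x' y' → x ~ x' × y ~ y' × E G i x' y' }

TPoly : ∀ {n} → Polytope n → CGraph n
TPoly P = Quotient (FlagGraph P) SameOrbitP

TManiplex : ∀ {n} → CGraph n → CGraph n
TManiplex G = Quotient G (SameOrbitG G)

MixPoly : ∀ {n} (P : Polytope n) → Flag P → (Q : Polytope n) → Flag Q → CGraph n
MixPoly P Φ Q Ψ = Mix (FlagGraph P) Φ (FlagGraph Q) Ψ

MixT : ∀ {n} (P : Polytope n) → Flag P → (Q : Polytope n) → Flag Q → CGraph n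
MixT P Φ Q Ψ = Mix (TPoly P) Φ (TPoly Q) Ψ

record SurjHom {n} (G H : CGraph n) : Set where
  field
    h      : V G → V H
    h-cong : ∀ {x y} → _≈_ G x y → _≈_ H (h x) (h y)
    h-hom  : ∀ i {x y} → E G i x y → E H i (h x) (h y)
    h-surj : ∀ y → ∃ λ x → _≈_ H (h x) y

-- An automorphism of a polytope fixes ranks, so it moves flags to flags and commutes with
-- taking i-adjacent flags. Hence an i-edge between orbits of T(P) can be lifted at any flag
-- of the source orbit, and a walk in T(P,Φ) ◇ T(Q,Ψ) from the root lifts, coordinatewise,
-- to a walk in (P,Φ) ◇ (Q,Ψ) ending at a pair of flags in the prescribed pair of orbits.
-- The orbit of such a lift under Aut((P,Φ) ◇ (Q,Ψ)) depends only on the pair of orbits,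
-- because a pair (α, β) ∈ Aut(P) × Aut(Q) carrying one flag of the mix to another maps the
-- whole connected component onto itself. Surjectivity holds because every walk in the mix
-- projects to a walk in the mix of the symmetry type graphs.
module Submission where

open import Defs
open import Data.Nat as ℕ using (ℕ; z≤n)
import Data.Nat.Properties as ℕ
open import Data.Fin as F using (Fin; toℕ; inject₁; opposite)
import Data.Fin.Properties as F
open import Data.Product using (Σ; _×_; _,_; proj₁; proj₂)
open import Data.Product.Relation.Binary.Pointwise.NonDependent using (×-isEquivalence; ×-setoid)
open import Function using (id; _∘_)
open import Level using (0ℓ)
open import Relation.Binary using (Setoid; IsEquivalence; _Preserves_⟶_)
import Relation.Binary.Reasoning.Setoid as SetoidReasoning
open import Relation.Binary.PropositionalEquality
open import Relation.Nullary using (¬_)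

StrictlyIncreasing : ∀ {m m′} → (Fin m → Fin m′) → Set
StrictlyIncreasing g = g Preserves F._<_ ⟶ F._<_

inject₁-strictlyIncreasing : ∀ {m} → StrictlyIncreasing (inject₁ {n = m})
inject₁-strictlyIncreasing {x = i} {j} i<j =
  subst₂ ℕ._<_ (sym (F.toℕ-inject₁ i)) (sym (F.toℕ-inject₁ j)) i<j

opposite-reverses-< : ∀ {m} {i j : Fin m} → i F.< j → opposite j F.< opposite i
opposite-reverses-< {m} {i} {j} i<j =
  subst₂ ℕ._<_ (sym (F.opposite-prop j)) (sym (F.opposite-prop i))
    (ℕ.∸-monoʳ-< (ℕ.s≤s i<j) (F.toℕ<n j))

strictlyIncreasing⇒≤ : ∀ {m m′} (g : Fin m → Fin m′) → StrictlyIncreasing g →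
                       ∀ i → toℕ i ℕ.≤ toℕ (g i)
strictlyIncreasing⇒≤ g g↑ F.zero    = z≤n
strictlyIncreasing⇒≤ g g↑ (F.suc i) =
  ℕ.≤-<-trans (strictlyIncreasing⇒≤ (g ∘ inject₁) (g↑ ∘ inject₁-strictlyIncreasing) i)
              (g↑ (F.≤̄⇒inject₁< ℕ.≤-refl))

strictlyIncreasing⇒≗id : ∀ {m} (g : Fin m → Fin m) → StrictlyIncreasing g → g ≗ id
strictlyIncreasing⇒≗id g g↑ i =
  F.toℕ-injective (ℕ.≤-antisym (ℕ.≮⇒≥ i≮gi) (strictlyIncreasing⇒≤ g g↑ i))
  where
    -- the lower bound for the reflected map is an upper bound for g
    reflected-≤ : toℕ (opposite i) ℕ.≤ toℕ (opposite (g i))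
    reflected-≤ = subst (λ k → toℕ (opposite i) ℕ.≤ toℕ (opposite (g k))) (F.opposite-involutive i)
      (strictlyIncreasing⇒≤ (opposite ∘ g ∘ opposite)
        (opposite-reverses-< ∘ g↑ ∘ opposite-reverses-<) (opposite i))

    i≮gi : ¬ (toℕ i ℕ.< toℕ (g i))
    i≮gi i<gi = ℕ.<⇒≱ (opposite-reverses-< i<gi) reflected-≤

record IsUndirected {n} (G : CGraph n) : Set where
  field
    ≈-isEquivalence : IsEquivalence (_≈_ G)
    E-sym           : ∀ i {x y} → E G i x y → E G i y x
    E-respʳ         : ∀ i {x y y′} → E G i x y → _≈_ G y y′ → E G i x y′

Product-isUndirected : ∀ {n} {G H : CGraph n} →
                       IsUndirected G → IsUndirected H → IsUndirected (Product G H)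
Product-isUndirected uG uH = record
  { ≈-isEquivalence = ×-isEquivalence (≈-isEquivalence uG) (≈-isEquivalence uH)
  ; E-sym           = λ i (e , e′) → E-sym uG i e , E-sym uH i e′
  ; E-respʳ         = λ i (e , e′) (p , p′) → E-respʳ uG i e p , E-respʳ uH i e′ p′
  }
  where open IsUndirected

Product-aut : ∀ {n} {G H : CGraph n} → GraphAut G → GraphAut H → GraphAut (Product G H)
Product-aut α β = record
  { f      = λ (x , y) → f α x , f β y
  ; g      = λ (x , y) → g α x , g β y
  ; f-cong = λ (p , q) → f-cong α p , f-cong β q
  ; g-cong = λ (p , q) → g-cong α p , g-cong β q
  ; fg     = λ (x , y) → fg α x , fg β y
  ; gf     = λ (x , y) → gf α x , gf β y
  ; f-hom  = λ i (e , e′) → f-hom α i e , f-hom β i e′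
  ; g-hom  = λ i (e , e′) → g-hom α i e , g-hom β i e′
  }
  where open GraphAut

Quotient-edge : ∀ {n} (G : CGraph n) (_~_ : V G → V G → Set) → (∀ {x} → x ~ x) →
                ∀ i {x y} → E G i x y → E (Quotient G _~_) i x y
Quotient-edge G _~_ ~-refl i {x} {y} e = x , y , ~-refl , ~-refl , e

Reach-map : ∀ {n} {G H : CGraph n} (h : V G → V H) →
            (∀ {x y} → _≈_ G x y → _≈_ H (h x) (h y)) →
            (∀ i {x y} → E G i x y → E H i (h x) (h y)) →
            ∀ {r x} → Reach G r x → Reach H (h r) (h x)
Reach-map h h-cong h-hom (here p)     = here (h-cong p)
Reach-map h h-cong h-hom (step i r e) = step i (Reach-map h h-cong h-hom r) (h-hom i e)

module Reachability {n} {G : CGraph n} (G-undirected : IsUndirected G) where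
  open IsUndirected G-undirected
  open IsEquivalence ≈-isEquivalence renaming (refl to ≈-refl; sym to ≈-sym; trans to ≈-trans)

  Reach-resp : ∀ {r x y} → Reach G r x → _≈_ G x y → Reach G r y
  Reach-resp (here p)     q = here (≈-trans (≈-sym q) p)
  Reach-resp (step i r e) q = step i r (E-respʳ i e q)

  Reach-trans : ∀ {r x y} → Reach G r x → Reach G x y → Reach G r y
  Reach-trans r⇝x (here p)     = Reach-resp r⇝x (≈-sym p)
  Reach-trans r⇝x (step i r e) = step i (Reach-trans r⇝x r) e

  Reach-sym : ∀ {r x} → Reach G r x → Reach G x r
  Reach-sym (here p)     = here (≈-sym p)
  Reach-sym (step i r e) = Reach-trans (step i (here ≈-refl) (E-sym i e)) (Reach-sym r)

  -- r ⇝ h x ⇝ h r ⇝ h y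
  mapComponent : ∀ {r x} (h : V G → V G) →
                 (∀ {y z} → _≈_ G y z → _≈_ G (h y) (h z)) →
                 (∀ i {y z} → E G i y z → E G i (h y) (h z)) →
                 Reach G r x → Reach G r (h x) → V (Component G r) → V (Component G r)
  mapComponent h h-cong h-hom r⇝x r⇝hx (y , r⇝y) =
    h y , Reach-trans (Reach-trans r⇝hx (Reach-sym (map r⇝x))) (map r⇝y)
    where map = Reach-map h h-cong h-hom

  restrictAut : (α : GraphAut G) → ∀ {r x} → Reach G r x → Reach G r (GraphAut.f α x) →
                GraphAut (Component G r)
  restrictAut α {x = x} r⇝x r⇝fx = record
    { f      = mapComponent f f-cong f-hom r⇝x r⇝fx
    ; g      = mapComponent g g-cong g-hom r⇝fx (Reach-resp r⇝x (≈-sym (gf x)))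
    ; f-cong = f-cong
    ; g-cong = g-cong
    ; fg     = fg ∘ proj₁
    ; gf     = gf ∘ proj₁
    ; f-hom  = λ i → f-hom i
    ; g-hom  = λ i → g-hom i
    }
    where open GraphAut α

module PolytopeAutomorphisms {n} (P : Polytope n) where
  open Polytope P
  open PolyAut

  idᴬ : PolyAut P
  idᴬ = record { σ = id ; σ⁻¹ = id ; σσ⁻¹ = λ _ → refl ; σ⁻¹σ = λ _ → refl
               ; σ-mono = id ; σ-refl = id }

  _⁻¹ᴬ : PolyAut P → PolyAut P
  α ⁻¹ᴬ = record
    { σ = σ⁻¹ α ; σ⁻¹ = σ α ; σσ⁻¹ = σ⁻¹σ α ; σ⁻¹σ = σσ⁻¹ α
    ; σ-mono = λ {F} {G} F≤G → σ-refl α (subst₂ _≤_ (sym (σσ⁻¹ α F)) (sym (σσ⁻¹ α G)) F≤G)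
    ; σ-refl = λ {F} {G} F≤G → subst₂ _≤_ (σσ⁻¹ α F) (σσ⁻¹ α G) (σ-mono α F≤G)
    }

  _∘ᴬ_ : PolyAut P → PolyAut P → PolyAut P
  β ∘ᴬ α = record
    { σ = σ β ∘ σ α ; σ⁻¹ = σ⁻¹ α ∘ σ⁻¹ β
    ; σσ⁻¹ = λ F → trans (cong (σ β) (σσ⁻¹ α _)) (σσ⁻¹ β F)
    ; σ⁻¹σ = λ F → trans (cong (σ⁻¹ α) (σ⁻¹σ β _)) (σ⁻¹σ α F)
    ; σ-mono = σ-mono β ∘ σ-mono α
    ; σ-refl = σ-refl α ∘ σ-refl β
    }

  σ-injective : (α : PolyAut P) → ∀ {F G} → σ α F ≡ σ α G → F ≡ G
  σ-injective α {F} {G} σF≡σG = begin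
    F               ≡⟨ σ⁻¹σ α F ⟨
    σ⁻¹ α (σ α F)   ≡⟨ cong (σ⁻¹ α) σF≡σG ⟩
    σ⁻¹ α (σ α G)   ≡⟨ σ⁻¹σ α G ⟩
    G               ∎
    where open ≡-Reasoning

  -- Along a flag the ranks after applying σ form a strictly increasing self-map of the ranks.
  σ-preserves-rank : (α : PolyAut P) (Φ : Flag P) → ∀ k → rank (σ α (face Φ k)) ≡ k
  σ-preserves-rank α Φ = strictlyIncreasing⇒≗id (λ k → rank (σ α (face Φ k))) increasing
    where
      increasing : StrictlyIncreasing (λ k → rank (σ α (face Φ k)))
      increasing {i} {j} i<j = rank-mono (σ-mono α (face-chain Φ i j (ℕ.<⇒≤ i<j)) , distinct)
        where
          distinct : σ α (face Φ i) ≢ σ α (face Φ j)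
          distinct σΦi≡σΦj = F.<-irrefl i≡j i<j
            where
              i≡j : i ≡ j
              i≡j = trans (sym (face-rank Φ i))
                      (trans (cong rank (σ-injective α σΦi≡σΦj)) (face-rank Φ j))

  act : PolyAut P → Flag P → Flag P
  act α Φ = record
    { face       = σ α ∘ face Φ
    ; face-rank  = σ-preserves-rank α Φ
    ; face-chain = λ i j i≤j → σ-mono α (face-chain Φ i j i≤j)
    }

  Adj-act : (α : PolyAut P) → ∀ i {Φ Ψ} → Adj i Φ Ψ → Adj i (act α Φ) (act α Ψ)
  Adj-act α i (same , differ) = (λ k k≢i → cong (σ α) (same k k≢i)) , differ ∘ σ-injective α

  Adj-respˡ : ∀ i {Φ Φ′ Ψ : Flag P} → Φ ≈F Φ′ → Adj i Φ Ψ → Adj i Φ′ Ψ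
  Adj-respˡ i Φ≈Φ′ (same , differ) =
    (λ k k≢i → trans (sym (Φ≈Φ′ k)) (same k k≢i)) , λ eq → differ (trans (Φ≈Φ′ _) eq)

  FlagGraph-isUndirected : IsUndirected (FlagGraph P)
  FlagGraph-isUndirected = record
    { ≈-isEquivalence = record
        { refl = λ _ → refl ; sym = λ p k → sym (p k) ; trans = λ p q k → trans (p k) (q k) }
    ; E-sym   = λ i (same , differ) → (λ k k≢i → sym (same k k≢i)) , differ ∘ sym
    ; E-respʳ = λ i (same , differ) Ψ≈Ψ′ →
        (λ k k≢i → trans (same k k≢i) (Ψ≈Ψ′ k)) , λ eq → differ (trans eq (sym (Ψ≈Ψ′ _)))
    }

  flagGraphAut : PolyAut P → GraphAut (FlagGraph P)
  flagGraphAut α = record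
    { f      = act α
    ; g      = act (α ⁻¹ᴬ)
    ; f-cong = λ p k → cong (σ α) (p k)
    ; g-cong = λ p k → cong (σ⁻¹ α) (p k)
    ; fg     = λ Φ k → σσ⁻¹ α (face Φ k)
    ; gf     = λ Φ k → σ⁻¹σ α (face Φ k)
    ; f-hom  = Adj-act α
    ; g-hom  = Adj-act (α ⁻¹ᴬ)
    }

  orbitSetoid : Setoid 0ℓ 0ℓ
  orbitSetoid = record
    { Carrier       = Flag P
    ; _≈_           = SameOrbitP
    ; isEquivalence = record
        { refl  = idᴬ , λ _ → refl
        ; sym   = λ (α , e) → α ⁻¹ᴬ , λ k → trans (cong (σ⁻¹ α) (sym (e k))) (σ⁻¹σ α _)
        ; trans = λ (α , e) (β , e′) → β ∘ᴬ α , λ k → trans (cong (σ β) (e k)) (e′ k)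
        }
    }

  liftQuotientEdge : ∀ i {Φ X Y} → SameOrbitP Φ X → E (TPoly P) i X Y →
                     Σ (Flag P) λ Ψ → Adj i Φ Ψ × SameOrbitP Ψ Y
  liftQuotientEdge i {Φ} {X} {Y} Φ∼X (X′ , Y′ , X∼X′ , Y∼Y′ , X′-Y′) =
    act γ Y′ , Adj-respˡ i {act γ X′} {Φ} {act γ Y′} γX′≈Φ (Adj-act γ i {X′} {Y′} X′-Y′) , γY′∼Y
    where
      open SetoidReasoning orbitSetoid
      X′∼Φ : SameOrbitP X′ Φ
      X′∼Φ = begin X′ ≈⟨ X∼X′ ⟨ X ≈⟨ Φ∼X ⟨ Φ ∎
      γ = proj₁ X′∼Φ
      γX′≈Φ : act γ X′ ≈F Φ
      γX′≈Φ = proj₂ X′∼Φ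
      γY′∼Y : SameOrbitP (act γ Y′) Y
      γY′∼Y = begin act γ Y′ ≈⟨ γ ⁻¹ᴬ , (λ k → σ⁻¹σ γ (face Y′ k)) ⟩ Y′ ≈⟨ Y∼Y′ ⟨ Y ∎

module MixOfRootedPolytopes {n} (P : Polytope n) (Φ : Flag P) (Q : Polytope n) (Ψ : Flag Q) where
  private
    module ᴾ = PolytopeAutomorphisms P
    module ᵠ = PolytopeAutomorphisms Q

  Flags : CGraph n
  Flags = Product (FlagGraph P) (FlagGraph Q)

  Types : CGraph n
  Types = Product (TPoly P) (TPoly Q)

  M : CGraph n
  M = MixPoly P Φ Q Ψ

  open Reachability (Product-isUndirected ᴾ.FlagGraph-isUndirected ᵠ.FlagGraph-isUndirected)
  open SetoidReasoning (×-setoid ᴾ.orbitSetoid ᵠ.orbitSetoid)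

  sameOrbits⇒SameOrbitG : (m m′ : V M) → _≈_ Types (proj₁ m) (proj₁ m′) → SameOrbitG M m m′
  sameOrbits⇒SameOrbitG (x , root⇝x) (x′ , root⇝x′) ((α , αx≈x′) , (β , βx≈x′)) =
    restrictAut γ root⇝x (Reach-resp root⇝x′ ((λ k → sym (αx≈x′ k)) , (λ k → sym (βx≈x′ k)))) ,
    (αx≈x′ , βx≈x′)
    where γ = Product-aut (ᴾ.flagGraphAut α) (ᵠ.flagGraphAut β)

  ≈ᵀ-refl : ∀ {x} → _≈_ Types x x
  ≈ᵀ-refl = (ᴾ.idᴬ , λ _ → refl) , (ᵠ.idᴬ , λ _ → refl)

  record Over (x : Flag P × Flag Q) : Set where
    constructor _lies-over-by_
    field
      vertex  : V M
      orbitOf : _≈_ Types (proj₁ vertex) x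
  open Over public

  Over⇒SameOrbitG : ∀ {x y} (o : Over x) (o′ : Over y) → _≈_ Types x y →
                    SameOrbitG M (vertex o) (vertex o′)
  Over⇒SameOrbitG {x} {y} (m lies-over-by m∼x) (m′ lies-over-by m′∼y) x∼y =
    sameOrbits⇒SameOrbitG m m′ (begin proj₁ m ≈⟨ m∼x ⟩ x ≈⟨ x∼y ⟩ y ≈⟨ m′∼y ⟨ proj₁ m′ ∎)

  liftEdge : ∀ i {x y} (o : Over x) → E Types i x y →
             Σ (Over y) λ o′ → E M i (vertex o) (vertex o′)
  liftEdge i {x₁ , x₂} {y₁ , y₂} (((A , B) , root⇝AB) lies-over-by (A∼x₁ , B∼x₂)) (e , e′) =
    let (A′ , A-A′ , A′∼y₁) = ᴾ.liftQuotientEdge i {A} {x₁} {y₁} A∼x₁ e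
        (B′ , B-B′ , B′∼y₂) = ᵠ.liftQuotientEdge i {B} {x₂} {y₂} B∼x₂ e′
    in (((A′ , B′) , step i root⇝AB (A-A′ , B-B′)) lies-over-by (A′∼y₁ , B′∼y₂)) , (A-A′ , B-B′)

  lift : ∀ {x} → Reach Types (Φ , Ψ) x → Over x
  lift {x} (here x∼root)   = ((Φ , Ψ) , here ((λ _ → refl) , (λ _ → refl)))
                               lies-over-by (begin (Φ , Ψ) ≈⟨ x∼root ⟨ x ∎)
  lift     (step i r e) = proj₁ (liftEdge i (lift r) e)

  project : ∀ {x} → Reach Flags (Φ , Ψ) x → Reach Types (Φ , Ψ) x
  project = Reach-map id (λ (p , q) → (ᴾ.idᴬ , p) , (ᵠ.idᴬ , q))
    (λ i {x} {y} (e , e′) →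
        Quotient-edge (FlagGraph P) SameOrbitP (ᴾ.idᴬ , λ _ → refl) i {proj₁ x} {proj₁ y} e ,
        Quotient-edge (FlagGraph Q) SameOrbitP (ᵠ.idᴬ , λ _ → refl) i {proj₂ x} {proj₂ y} e′)

mainTheorem2 : ∀ {n : ℕ} (P : Polytope n) (Φ : Flag P) (Q : Polytope n) (Ψ : Flag Q) →
    SurjHom (MixT P Φ Q Ψ) (TManiplex (MixPoly P Φ Q Ψ))
mainTheorem2 P Φ Q Ψ = record
  { h      = λ (_ , r) → vertex (lift r)
  ; h-cong = λ { {_ , r} {_ , s} x∼y → Over⇒SameOrbitG (lift r) (lift s) x∼y }
  ; h-hom  = λ { i {x , r} {y , s} e →
      let (o , o-edge) = liftEdge i {y = y} (lift r) e
      in vertex (lift r) , vertex o , Over⇒SameOrbitG (lift r) (lift r) (≈ᵀ-refl {x})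
         , Over⇒SameOrbitG (lift s) o (≈ᵀ-refl {y}) , o-edge }
  ; h-surj = λ (m , r) →
      (m , project r) ,
      Over⇒SameOrbitG {m} {m} (lift (project r)) ((m , r) lies-over-by ≈ᵀ-refl {m}) (≈ᵀ-refl {m})
  }
  where open MixOfRootedPolytopes P Φ Q Ψ
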